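{- For integers $n\ge r\ge 2$ with $n\ge 3$, $\kappa(Q_n;K_{1,r})\le\lceil \frac{n}{2}\rceil$ and $\kappa^s(Q_n;K_{1,r})\le\lceil \frac{n}{2}\rceil$.
   Context: The $n$-dimensional hypercube $Q_n$ has as vertices all binary strings of length $n$, two strings being adjacent iff they differ in exactly one position. $K_{1,r}$ denotes the star with $r$ leaves. For a graph $G$ and a set $F$ of subgraphs of $G$, $G-F$ denotes the graph obtained from $G$ by deleting all vertices of all members of $F$. For a connected graph $T$, $\kappa(G;T)$ is the minimum cardinality of a set $F$ of subgraphs of $G$, each isomorphic to $T$, such that $G-F$ is disconnected; $\kappa^s(G;T)$ is the minimum cardinality of a set $F$ of subgraphs of $G$, each isomorphic to a connected subgraph of $T$, such that $G-F$ is disconnected. -}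

module Defs where

open import Data.Nat using (ℕ; zero; suc; _+_; _≤_)
open import Data.Bool using (Bool; true; false; _≟_)
open import Data.Vec using (Vec; []; _∷_)
open import Data.Fin using (Fin)
open import Data.List using (List)
open import Data.List.Relation.Unary.Any using (Any)
open import Data.Product using (Σ; ∃; ∃-syntax; _×_; _,_)
open import Data.Sum using (_⊎_)
open import Function.Definitions using (Injective)
open import Relation.Binary.PropositionalEquality using (_≡_)
open import Relation.Nullary using (¬_; yes; no)

QV : ℕ → Set
QV n = Vec Bool n

hamming : ∀ {n} → QV n → QV n → ℕ
hamming [] [] = 0
hamming (a ∷ u) (b ∷ v) with a ≟ b
... | yes _ = hamming u v
... | no  _ = suc (hamming u v)

QAdj : ∀ {n} → QV n → QV n → Set
QAdj u v = hamming u v ≡ 1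

-- A subgraph of G isomorphic to the star K_{1,s}: a centre together with
-- s pairwise distinct neighbours of the centre (the leaves).  The edges of
-- the subgraph are the centre–leaf edges.
record Star {V : Set} (Adj : V → V → Set) (s : ℕ) : Set where
  field
    centre     : V
    leaf       : Fin s → V
    leaf-inj   : Injective _≡_ _≡_ leaf
    leaf-adj   : ∀ i → Adj centre (leaf i)
open Star public

_∈ˢ_ : ∀ {V Adj s} → V → Star {V} Adj s → Set
x ∈ˢ S = x ≡ centre S ⊎ ∃[ i ] leaf S i ≡ x

-- A subgraph isomorphic to a connected subgraph of K_{1,r}.
-- The connected subgraphs of K_{1,r} are, up to isomorphism, exactly
-- K_{1,s} for 0 ≤ s ≤ r (K_{1,0} = K_1, K_{1,1} = K_2).
SubStar : ∀ {V : Set} (Adj : V → V → Set) (r : ℕ) → Set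
SubStar {V} Adj r = Σ ℕ λ s → s ≤ r × Star {V} Adj s

_∈ˢˢ_ : ∀ {V Adj r} → V → SubStar {V} Adj r → Set
x ∈ˢˢ (s , _ , S) = x ∈ˢ S

-- Reachability in G - D, where D : V → Set is the set of deleted vertices
data Reach {V : Set} (Adj : V → V → Set) (D : V → Set) : V → V → Set where
  here : ∀ {u} → ¬ D u → Reach Adj D u u
  step : ∀ {u v w} → ¬ D u → Adj u v → Reach Adj D v w → Reach Adj D u w

Disconnected : {V : Set} (Adj : V → V → Set) (D : V → Set) → Set
Disconnected {V} Adj D = ∃[ u ] ∃[ v ] (¬ D u × ¬ D v × ¬ Reach Adj D u v)

Covered : {V : Set} {A : Set} (_∈_ : V → A → Set) → List A → V → Set
Covered _∈_ F x = Any (x ∈_) F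

-- Split the coordinates of Q_n into ⌈n/2⌉ consecutive pairs {i, i+1}
-- (overlapping once when n is odd) and delete, for each pair, a star
-- K_{1,r} centred at e_i + e_{i+1} two of whose leaves are e_i and
-- e_{i+1}.  Every neighbour e_j of 0 is deleted, so 0 is isolated.  Leaves
-- of a star have the parity opposite to its centre, which is even; hence the
-- only even vertices deleted are the centres, and neither 0 nor e_0 + e_2 is
-- one of them.  So both survive in different components.
module Submission where

open import Defs
open import Data.Nat using (ℕ; zero; suc; _≤_; ⌈_/2⌉; z≤n; s≤s)
open import Data.Nat.Properties using (≤-refl; ≤-reflexive; suc-injective)
open import Data.Bool using (Bool; true; false; not; _xor_)
open import Data.Bool.Properties
  using (not-involutive; not-¬; not-distribˡ-xor; not-distribʳ-xor)
open import Data.Vec using ([]; _∷_; replicate; lookup; foldr′; _[_]%=_)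
open import Data.Vec.Properties
  using (lookup∘updateAt; lookup∘updateAt′; updateAt-updateAt; updateAt-cong;
         updateAt-id; updateAt-commutes; ∷-injectiveʳ)
open import Data.Fin using (Fin; zero; suc; punchIn; inject₁; inject≤)
open import Data.Fin.Properties
  using (punchIn-injective; punchInᵢ≢i; inject≤-injective)
  renaming (_≟_ to _≟ᶠ_)
open import Data.List using (List; []; _∷_; length; map)
open import Data.List.Properties using (length-map)
open import Data.List.Relation.Unary.Any using (Any; here; there; satisfied)
import Data.List.Relation.Unary.Any as Any
open import Data.List.Relation.Unary.Any.Properties using (map⁺; map⁻)
open import Data.Product using (_×_; ∃-syntax; _,_)
open import Data.Sum using (_⊎_; inj₁; inj₂)
open import Data.Empty using (⊥-elim)
open import Relation.Nullary using (¬_; yes; no)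
open import Relation.Binary.PropositionalEquality
open import Function.Definitions using (Injective)

private
  variable
    n : ℕ

Reach-source : ∀ {V : Set} {Adj : V → V → Set} {D : V → Set} {u v : V} →
               Reach Adj D u v → ¬ D u
Reach-source (here ¬Du)     = ¬Du
Reach-source (step ¬Du _ _) = ¬Du

isolated⇒disconnected : ∀ {V : Set} {Adj : V → V → Set} {D : V → Set} {u v : V} →
                        (∀ w → Adj u w → D w) → ¬ D u → ¬ D v → v ≢ u →
                        Disconnected Adj D
isolated⇒disconnected {u = u} {v} N[u]⊆D ¬Du ¬Dv v≢u = u , v , ¬Du , ¬Dv , no-path
  where
  no-path : ¬ Reach _ _ u v
  no-path (here _)          = v≢u refl
  no-path (step _ adj path) = Reach-source path (N[u]⊆D _ adj)

flipAt : Fin n → QV n → QV n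
flipAt i x = x [ i ]%= not

0ᵛ : QV n
0ᵛ = replicate _ false

e : Fin n → QV n
e i = flipAt i 0ᵛ

hamming-self : (x : QV n) → hamming x x ≡ 0
hamming-self []          = refl
hamming-self (false ∷ x) = hamming-self x
hamming-self (true ∷ x)  = hamming-self x

hamming≡0⇒≡ : (x y : QV n) → hamming x y ≡ 0 → x ≡ y
hamming≡0⇒≡ []          []          _ = refl
hamming≡0⇒≡ (false ∷ x) (false ∷ y) h = cong (false ∷_) (hamming≡0⇒≡ x y h)
hamming≡0⇒≡ (true ∷ x)  (true ∷ y)  h = cong (true ∷_) (hamming≡0⇒≡ x y h)

flipAt-adjacent : (i : Fin n) (x : QV n) → QAdj x (flipAt i x)
flipAt-adjacent zero    (false ∷ x) = cong suc (hamming-self x)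
flipAt-adjacent zero    (true ∷ x)  = cong suc (hamming-self x)
flipAt-adjacent (suc i) (false ∷ x) = flipAt-adjacent i x
flipAt-adjacent (suc i) (true ∷ x)  = flipAt-adjacent i x

adjacent⇒flipAt : (x y : QV n) → QAdj x y → ∃[ i ] y ≡ flipAt i x
adjacent⇒flipAt []          []          ()
adjacent⇒flipAt (false ∷ x) (false ∷ y) adj with i , y≡ ← adjacent⇒flipAt x y adj =
  suc i , cong (false ∷_) y≡
adjacent⇒flipAt (true ∷ x)  (true ∷ y)  adj with i , y≡ ← adjacent⇒flipAt x y adj =
  suc i , cong (true ∷_) y≡
adjacent⇒flipAt (false ∷ x) (true ∷ y)  adj =
  zero , cong (true ∷_) (sym (hamming≡0⇒≡ x y (suc-injective adj)))
adjacent⇒flipAt (true ∷ x)  (false ∷ y) adj =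
  zero , cong (false ∷_) (sym (hamming≡0⇒≡ x y (suc-injective adj)))

flipAt-involutive : (i : Fin n) (x : QV n) → flipAt i (flipAt i x) ≡ x
flipAt-involutive i x = begin
  flipAt i (flipAt i x)         ≡⟨ updateAt-updateAt i x ⟩
  x [ i ]%= (λ b → not (not b)) ≡⟨ updateAt-cong i not-involutive x ⟩
  x [ i ]%= (λ b → b)           ≡⟨ updateAt-id i x ⟩
  x                             ∎
  where open ≡-Reasoning

flipAt-injective : (x : QV n) → Injective _≡_ _≡_ (λ i → flipAt i x)
flipAt-injective x {i} {j} eq with i ≟ᶠ j
... | yes i≡j = i≡j
... | no  i≢j = ⊥-elim (not-¬ refl (sym (begin
  not (lookup x i)       ≡⟨ lookup∘updateAt i x ⟨
  lookup (flipAt i x) i  ≡⟨ cong (λ y → lookup y i) eq ⟩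
  lookup (flipAt j x) i  ≡⟨ lookup∘updateAt′ i j i≢j x ⟩
  lookup x i             ∎)))
  where open ≡-Reasoning

parity : QV n → Bool
parity = foldr′ _xor_ false

parity-flipAt : (i : Fin n) (x : QV n) → parity (flipAt i x) ≡ not (parity x)
parity-flipAt zero    (b ∷ x) = sym (not-distribˡ-xor b (parity x))
parity-flipAt (suc i) (b ∷ x) =
  trans (cong (b xor_) (parity-flipAt i x)) (sym (not-distribʳ-xor b (parity x)))

QAdj⇒parity-flips : (x y : QV n) → QAdj x y → parity y ≡ not (parity x)
QAdj⇒parity-flips x y adj with i , refl ← adjacent⇒flipAt x y adj = parity-flipAt i x

parity-0ᵛ : ∀ n → parity (0ᵛ {n}) ≡ false
parity-0ᵛ zero    = refl
parity-0ᵛ (suc n) = parity-0ᵛ n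

parity-flipAt-e : (i j : Fin n) → parity (flipAt i (e j)) ≡ false
parity-flipAt-e {n} i j = begin
  parity (flipAt i (e j))       ≡⟨ parity-flipAt i (e j) ⟩
  not (parity (e j))            ≡⟨ cong not (parity-flipAt j 0ᵛ) ⟩
  not (not (parity (0ᵛ {n})))   ≡⟨ not-involutive _ ⟩
  parity (0ᵛ {n})               ≡⟨ parity-0ᵛ n ⟩
  false                         ∎
  where open ≡-Reasoning

flipStar : (c : QV n) {s : ℕ} (π : Fin s → Fin n) → Injective _≡_ _≡_ π →
           Star (QAdj {n}) s
flipStar c π π-inj = record
  { centre   = c
  ; leaf     = λ k → flipAt (π k) c
  ; leaf-inj = λ eq → π-inj (flipAt-injective c eq)
  ; leaf-adj = λ k → flipAt-adjacent (π k) c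
  }

∉Star : ∀ {x : QV n} {s} (S : Star (QAdj {n}) s) →
        parity x ≡ parity (centre S) → x ≢ centre S → ¬ (x ∈ˢ S)
∉Star S px≡pc x≢c (inj₁ x≡c)       = x≢c x≡c
∉Star S px≡pc _   (inj₂ (k , refl)) =
  not-¬ px≡pc (QAdj⇒parity-flips (centre S) (leaf S k) (leaf-adj S k))

_◃_ : ∀ {m s} → Fin (suc m) → (Fin s → Fin m) → Fin (suc s) → Fin (suc m)
(p ◃ f) zero    = p
(p ◃ f) (suc k) = punchIn p (f k)

◃-injective : ∀ {m s} (p : Fin (suc m)) {f : Fin s → Fin m} →
              Injective _≡_ _≡_ f → Injective _≡_ _≡_ (p ◃ f)
◃-injective p f-inj {zero}  {zero}  _  = refl
◃-injective p f-inj {zero}  {suc l} eq = ⊥-elim (punchInᵢ≢i p _ (sym eq))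
◃-injective p f-inj {suc k} {zero}  eq = ⊥-elim (punchInᵢ≢i p _ eq)
◃-injective p f-inj {suc k} {suc l} eq = cong suc (f-inj (punchIn-injective p _ _ eq))

punchIn-inject₁ : ∀ {m} (i : Fin m) → punchIn (inject₁ i) i ≡ suc i
punchIn-inject₁ zero    = refl
punchIn-inject₁ (suc i) = cong suc (punchIn-inject₁ i)

inject₁≢suc : ∀ {m} (i : Fin m) → inject₁ i ≢ suc i
inject₁≢suc i eq = punchInᵢ≢i (inject₁ i) i (trans (punchIn-inject₁ i) (sym eq))

pairCentre : ∀ {m} → Fin (suc m) → QV (suc (suc m))
pairCentre i = flipAt (inject₁ i) (e (suc i))

pairCentre≢0ᵛ : ∀ {m} (i : Fin (suc m)) → pairCentre i ≢ 0ᵛ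
pairCentre≢0ᵛ zero ()
pairCentre≢0ᵛ {suc m} (suc i) eq = pairCentre≢0ᵛ i (∷-injectiveʳ eq)

module PairStars {m s : ℕ} (s≤m : s ≤ m) where

  pairLeaves : Fin (suc m) → Fin (suc (suc s)) → Fin (suc (suc m))
  pairLeaves i = inject₁ i ◃ (i ◃ λ k → inject≤ k s≤m)

  pairStar : Fin (suc m) → Star (QAdj {suc (suc m)}) (suc (suc s))
  pairStar i = flipStar (pairCentre i) (pairLeaves i)
    (◃-injective _ (◃-injective i (λ {k} {l} → inject≤-injective s≤m s≤m k l)))

  e-inject₁∈pairStar : (i : Fin (suc m)) → e (inject₁ i) ∈ˢ pairStar i
  e-inject₁∈pairStar i = inj₂ (suc zero , (begin
    flipAt (punchIn (inject₁ i) i) (pairCentre i)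
      ≡⟨ cong (λ j → flipAt j (pairCentre i)) (punchIn-inject₁ i) ⟩
    flipAt (suc i) (flipAt (inject₁ i) (flipAt (suc i) 0ᵛ))
      ≡⟨ cong (flipAt (suc i)) (updateAt-commutes (inject₁ i) (suc i) (inject₁≢suc i) 0ᵛ) ⟩
    flipAt (suc i) (flipAt (suc i) (e (inject₁ i)))
      ≡⟨ flipAt-involutive (suc i) (e (inject₁ i)) ⟩
    e (inject₁ i) ∎))
    where open ≡-Reasoning

  e-suc∈pairStar : (i : Fin (suc m)) → e (suc i) ∈ˢ pairStar i
  e-suc∈pairStar i = inj₂ (zero , flipAt-involutive (inject₁ i) (e (suc i)))

  0ᵛ∉pairStar : (i : Fin (suc m)) → ¬ (0ᵛ ∈ˢ pairStar i)
  0ᵛ∉pairStar i = ∉Star (pairStar i)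
    (trans (parity-0ᵛ (suc (suc m))) (sym (parity-flipAt-e (inject₁ i) (suc i))))
    (λ eq → pairCentre≢0ᵛ i (sym eq))

pairStarts : ∀ m → List (Fin (suc m))
pairStarts zero          = zero ∷ []
pairStarts (suc zero)    = zero ∷ suc zero ∷ []
pairStarts (suc (suc m)) = zero ∷ map (λ i → suc (suc i)) (pairStarts m)

length-pairStarts : ∀ m → length (pairStarts m) ≡ ⌈ suc (suc m) /2⌉
length-pairStarts zero          = refl
length-pairStarts (suc zero)    = refl
length-pairStarts (suc (suc m)) =
  cong suc (trans (length-map _ (pairStarts m)) (length-pairStarts m))

InPair : ∀ {m} → Fin (suc (suc m)) → Fin (suc m) → Set
InPair j i = j ≡ inject₁ i ⊎ j ≡ suc i

pairStarts-cover : ∀ m (j : Fin (suc (suc m))) → Any (InPair j) (pairStarts m)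
pairStarts-cover zero          zero             = here (inj₁ refl)
pairStarts-cover zero          (suc zero)       = here (inj₂ refl)
pairStarts-cover (suc zero)    zero             = here (inj₁ refl)
pairStarts-cover (suc zero)    (suc zero)       = here (inj₂ refl)
pairStarts-cover (suc zero)    (suc (suc zero)) = there (here (inj₂ refl))
pairStarts-cover (suc (suc m)) zero             = here (inj₁ refl)
pairStarts-cover (suc (suc m)) (suc zero)       = here (inj₂ refl)
pairStarts-cover (suc (suc m)) (suc (suc j))    =
  there (map⁺ (Any.map shift (pairStarts-cover m j)))
  where
  shift : ∀ {i} → InPair j i → InPair (suc (suc j)) (suc (suc i))
  shift (inj₁ eq) = inj₁ (cong (λ k → suc (suc k)) eq)
  shift (inj₂ eq) = inj₂ (cong (λ k → suc (suc k)) eq)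

module PairStarCut {k s : ℕ} (s≤k+1 : s ≤ suc k) where
  open PairStars s≤k+1

  Q : ℕ
  Q = suc (suc (suc k))

  F : List (Star (QAdj {Q}) (suc (suc s)))
  F = map pairStar (pairStarts (suc k))

  e₀₂ : QV Q
  e₀₂ = flipAt zero (e (suc (suc zero)))

  e₀₂∉pairStar : (i : Fin (suc (suc k))) → ¬ (e₀₂ ∈ˢ pairStar i)
  e₀₂∉pairStar i = ∉Star (pairStar i)
    (trans (parity-flipAt-e {Q} zero (suc (suc zero))) (sym (parity-flipAt-e (inject₁ i) (suc i))))
    (e₀₂≢pairCentre i)
    where
    e₀₂≢pairCentre : (i : Fin (suc (suc k))) → e₀₂ ≢ pairCentre i
    e₀₂≢pairCentre zero    ()
    e₀₂≢pairCentre (suc i) ()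

  ∉F : {x : QV Q} → (∀ i → ¬ (x ∈ˢ pairStar i)) → ¬ Covered _∈ˢ_ F x
  ∉F x∉ x∈F with i , x∈ ← satisfied (map⁻ x∈F) = x∉ i x∈

  neighbours-of-0ᵛ-∈F : ∀ w → QAdj 0ᵛ w → Covered _∈ˢ_ F w
  neighbours-of-0ᵛ-∈F w adj with j , refl ← adjacent⇒flipAt 0ᵛ w adj =
    map⁺ (Any.map e∈pairStar (pairStarts-cover (suc k) j))
    where
    e∈pairStar : ∀ {i} → InPair j i → e j ∈ˢ pairStar i
    e∈pairStar {i} (inj₁ refl) = e-inject₁∈pairStar i
    e∈pairStar {i} (inj₂ refl) = e-suc∈pairStar i

  ≐F⇒disconnected : (D : QV Q → Set) → (∀ x → D x → Covered _∈ˢ_ F x) →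
                    (∀ x → Covered _∈ˢ_ F x → D x) → Disconnected QAdj D
  ≐F⇒disconnected D D⊆F F⊆D = isolated⇒disconnected
    (λ w adj → F⊆D w (neighbours-of-0ᵛ-∈F w adj))
    (λ 0∈D → ∉F 0ᵛ∉pairStar (D⊆F _ 0∈D))
    (λ e₀₂∈D → ∉F e₀₂∉pairStar (D⊆F _ e₀₂∈D))
    (λ ())

  asSubStar : Star (QAdj {Q}) (suc (suc s)) → SubStar (QAdj {Q}) (suc (suc s))
  asSubStar S = _ , ≤-refl , S

  length-F : length F ≡ ⌈ Q /2⌉
  length-F = trans (length-map pairStar (pairStarts (suc k))) (length-pairStarts (suc k))

lemma3p7 : ∀ (n r : ℕ) → 2 ≤ r → r ≤ n → 3 ≤ n →
    (∃[ F ] (length F ≤ ⌈ n /2⌉ × Disconnected (QAdj {n}) (Covered {QV n} {Star (QAdj {n}) r} _∈ˢ_ F)))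
    × (∃[ F ] (length F ≤ ⌈ n /2⌉ × Disconnected (QAdj {n}) (Covered {QV n} {SubStar (QAdj {n}) r} _∈ˢˢ_ F)))
lemma3p7 (suc (suc (suc k))) (suc (suc s)) (s≤s (s≤s z≤n)) (s≤s (s≤s s≤k+1)) (s≤s (s≤s (s≤s z≤n))) =
    (F , ≤-reflexive length-F , ≐F⇒disconnected _ (λ _ x∈ → x∈) (λ _ x∈ → x∈))
  , ( map asSubStar F
    , ≤-reflexive (trans (length-map asSubStar F) length-F)
    , ≐F⇒disconnected _ (λ _ x∈ → map⁻ x∈) (λ _ x∈ → map⁺ x∈))
  where open PairStarCut s≤k+1
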